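{- If $K$ is a base term, then for every closed term $M$, $(\overline M)~K\to^{*}_{\ell\cup\beta}M:K$.
   Context: Fix a ring of scalars (elements $\alpha,\beta$). Terms: $M,N,L ::= V \mid (M)~N \mid \alpha.M \mid M+N$; values $V,W ::= 0 \mid B \mid \alpha.V \mid V+W$; base terms $B ::= x \mid \lambda x\,M$. $M[x:=N]$ is capture-avoiding substitution. Rewrite rules: $(\beta_v)$ $(\lambda x\,M)~B\to M[x:=B]$ ($B$ base). $(A_l)$ $(M+N)~V\to(M)~V+(N)~V$; $(\alpha.M)~V\to\alpha.(M)~V$; $(0)~V\to 0$ ($V$ value). $(A_r)$ $(B)~(M+N)\to(B)~M+(B)~N$; $(B)~(\alpha.M)\to\alpha.(B)~M$; $(B)~0\to 0$ ($B$ base). (Asso) $M+(N+L)\to(M+N)+L$ and $(M+N)+L\to M+(N+L)$. (Com) $M+N\to N+M$. $(F)$ $\alpha.M+\beta.M\to(\alpha+\beta).M$; $\alpha.M+M\to(\alpha+1).M$; $M+M\to(1+1).M$; $\alpha.(\beta.M)\to(\alpha\beta).M$. $(S)$ $\alpha.(M+N)\to\alpha.M+\alpha.N$; $1.M\to M$; $0.M\to 0$; $\alpha.0\to 0$; $0+M\to M$. Context rules $(\xi)$: from $M\to M'$ infer $(M)~N\to(M')~N$, $M+N\to M'+N$, $N+M\to N+M'$, $\alpha.M\to\alpha.M'$; $(\xi_{lin})$: from $M\to M'$ infer $(V)~M\to(V)~M'$ for $V$ a value. $\to_\ell$ is generated by $A_l\cup A_r\cup\mathrm{Asso}\cup\mathrm{Com}\cup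 F\cup S$ closed under $\xi,\xi_{lin}$; $\to_{\beta_v}$ by $\beta_v$ closed under $\xi,\xi_{lin}$; $\to_{\ell\cup\beta}:=\to_\ell\cup\to_{\beta_v}$; $R^{*}$ is reflexive-transitive closure. Translation (with $f,g,y$ fresh): $\overline{x}=x$; $\overline{0}=\lambda f\,(0)~f$; $\overline{\lambda x\,M}=\lambda f\,(f)~\lambda x\,\overline M$; $\overline{(M)~N}=\lambda f\,(\overline M)~\lambda g\,((g)~\overline N)~f$; $\overline{\alpha.M}=\lambda f\,(\alpha.\overline M)~f$; $\overline{M+N}=\lambda f\,(\overline M+\overline N)~f$; $\Phi(x)=(x)~\lambda y\,y$, $\Phi(0)=0$, $\Phi(\lambda x\,M)=\lambda x\,\overline M$, $\Phi(\alpha.V)=\alpha.\Phi(V)$, $\Phi(V+W)=\Phi(V)+\Phi(W)$. The binary operation $M:K$ (with $B$ a base term) is defined by: $0:K=0$; $B:K=(K)~\Phi(B)$; $\alpha.M:K=\alpha.(M:K)$; $M+N:K=(M:K)+(N:K)$; $(0)~N:K=0$; $(B)~N:K=((\Phi(B))~\overline N)~K$; $(\alpha.M)~N:K=(\alpha.((M)~N)):K$; $(M+N)~L:K=((M)~L+(N)~L):K$; $((M)~N)~L:K=(M)~N:\lambda f\,((f)~\overline L)~K$. -}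

module Defs where

open import Algebra.Bundles using (Ring)

open import Data.Nat using (ℕ; zero; suc)
open import Data.Fin using (Fin; zero; suc)
open import Data.Sum using (_⊎_)
open import Relation.Binary.Construct.Closure.ReflexiveTransitive using (Star)

module LinCalc {c ℓ} (R : Ring c ℓ) where

  open Ring R using (_+_; _*_; 0#; 1#) renaming (Carrier to S)

  infixl 6 _⊕_
  infixr 7 _·_

  data Term (n : ℕ) : Set c where
    var : Fin n → Term n
    lam : Term (suc n) → Term n
    app : Term n → Term n → Term n
    𝟎   : Term n
    _·_ : S → Term n → Term n
    _⊕_ : Term n → Term n → Term n

  data Base {n : ℕ} : Term n → Set c where
    var : (x : Fin n) → Base (var x)
    lam : (M : Term (suc n)) → Base (lam M)

  data Value {n : ℕ} : Term n → Set c where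
    zer  : Value 𝟎
    base : ∀ {B} → Base B → Value B
    scal : ∀ α {V} → Value V → Value (α · V)
    plus : ∀ {V W} → Value V → Value W → Value (V ⊕ W)

  Ren : ℕ → ℕ → Set
  Ren m n = Fin m → Fin n

  ext : ∀ {m n} → Ren m n → Ren (suc m) (suc n)
  ext ρ zero    = zero
  ext ρ (suc x) = suc (ρ x)

  ren : ∀ {m n} → Ren m n → Term m → Term n
  ren ρ (var x)   = var (ρ x)
  ren ρ (lam M)   = lam (ren (ext ρ) M)
  ren ρ (app M N) = app (ren ρ M) (ren ρ N)
  ren ρ 𝟎         = 𝟎
  ren ρ (α · M)   = α · ren ρ M
  ren ρ (M ⊕ N)   = ren ρ M ⊕ ren ρ N

  wk : ∀ {n} → Term n → Term (suc n)
  wk = ren suc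

  close↑ : ∀ {n} → Term 0 → Term n
  close↑ = ren (λ ())

  Sub : ℕ → ℕ → Set c
  Sub m n = Fin m → Term n

  exts : ∀ {m n} → Sub m n → Sub (suc m) (suc n)
  exts σ zero    = var zero
  exts σ (suc x) = wk (σ x)

  sub : ∀ {m n} → Sub m n → Term m → Term n
  sub σ (var x)   = σ x
  sub σ (lam M)   = lam (sub (exts σ) M)
  sub σ (app M N) = app (sub σ M) (sub σ N)
  sub σ 𝟎         = 𝟎
  sub σ (α · M)   = α · sub σ M
  sub σ (M ⊕ N)   = sub σ M ⊕ sub σ N

  _[_] : ∀ {n} → Term (suc n) → Term n → Term n
  M [ N ] = sub σ M
    where
    σ : Sub _ _
    σ zero    = N
    σ (suc x) = var x

  data _↦ℓ_ {n : ℕ} : Term n → Term n → Set c where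
    Al-+ : ∀ {M N V} → Value V → app (M ⊕ N) V ↦ℓ (app M V ⊕ app N V)
    Al-· : ∀ {α M V} → Value V → app (α · M) V ↦ℓ (α · app M V)
    Al-0 : ∀ {V} → Value V → app 𝟎 V ↦ℓ 𝟎
    Ar-+ : ∀ {B M N} → Base B → app B (M ⊕ N) ↦ℓ (app B M ⊕ app B N)
    Ar-· : ∀ {B α M} → Base B → app B (α · M) ↦ℓ (α · app B M)
    Ar-0 : ∀ {B} → Base B → app B 𝟎 ↦ℓ 𝟎
    asso₁ : ∀ {M N L} → (M ⊕ (N ⊕ L)) ↦ℓ ((M ⊕ N) ⊕ L)
    asso₂ : ∀ {M N L} → ((M ⊕ N) ⊕ L) ↦ℓ (M ⊕ (N ⊕ L))
    com : ∀ {M N} → (M ⊕ N) ↦ℓ (N ⊕ M)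
    F-αβ : ∀ {α β M} → (α · M ⊕ β · M) ↦ℓ ((α + β) · M)
    F-α1 : ∀ {α M} → (α · M ⊕ M) ↦ℓ ((α + 1#) · M)
    F-11 : ∀ {M} → (M ⊕ M) ↦ℓ ((1# + 1#) · M)
    F-** : ∀ {α β M} → (α · (β · M)) ↦ℓ ((α * β) · M)
    S-dist : ∀ {α M N} → (α · (M ⊕ N)) ↦ℓ (α · M ⊕ α · N)
    S-1    : ∀ {M} → (1# · M) ↦ℓ M
    S-0·   : ∀ {M} → (0# · M) ↦ℓ 𝟎
    S-·0   : ∀ {α} → (α · 𝟎) ↦ℓ 𝟎
    S-0+   : ∀ {M} → (𝟎 ⊕ M) ↦ℓ M

  data _↦β_ {n : ℕ} : Term n → Term n → Set c where
    βv : ∀ {M B} → Base B → app (lam M) B ↦β (M [ B ])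

  -- Closure of an axiom relation under the context rules ξ and ξ_lin
  -- (note: no reduction under λ)
  data Ctx (Ax : ∀ {n} → Term n → Term n → Set c) {n : ℕ} : Term n → Term n → Set c where
    ax    : ∀ {M M'} → Ax M M' → Ctx Ax M M'
    ξ-app : ∀ {M M' N} → Ctx Ax M M' → Ctx Ax (app M N) (app M' N)
    ξ-+l  : ∀ {M M' N} → Ctx Ax M M' → Ctx Ax (M ⊕ N) (M' ⊕ N)
    ξ-+r  : ∀ {M M' N} → Ctx Ax M M' → Ctx Ax (N ⊕ M) (N ⊕ M')
    ξ-·   : ∀ {α M M'} → Ctx Ax M M' → Ctx Ax (α · M) (α · M')
    ξ-lin : ∀ {V M M'} → Value V → Ctx Ax M M' → Ctx Ax (app V M) (app V M')

  _→ℓ_ : ∀ {n} → Term n → Term n → Set c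
  _→ℓ_ = Ctx _↦ℓ_

  _→βv_ : ∀ {n} → Term n → Term n → Set c
  _→βv_ = Ctx _↦β_

  _→ℓβ_ : ∀ {n} → Term n → Term n → Set c
  M →ℓβ N = (M →ℓ N) ⊎ (M →βv N)

  _→ℓβ*_ : ∀ {n} → Term n → Term n → Set c
  _→ℓβ*_ = Star _→ℓβ_

  -- Translation  M ↦ M̄  (fresh f,g are new de Bruijn binders)

  tr : ∀ {n} → Term n → Term n
  tr (var x)   = var x
  -- λf (0) f
  tr 𝟎         = lam (app 𝟎 (var zero))
  -- λf (f) λx M̄
  tr (lam M)   = lam (app (var zero) (lam (ren (ext suc) (tr M))))
  -- λf (M̄) λg ((g) N̄) f
  tr (app M N) = lam (app (wk (tr M))
                          (lam (app (app (var zero) (wk (wk (tr N)))) (var (suc zero)))))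
  -- λf (α.M̄) f
  tr (α · M)   = lam (app (α · wk (tr M)) (var zero))
  -- λf (M̄ + N̄) f
  tr (M ⊕ N)   = lam (app (wk (tr M) ⊕ wk (tr N)) (var zero))

  Φ : ∀ {n} {V : Term n} → Value V → Term n
  Φ zer               = 𝟎
  Φ (base (var x))    = app (var x) (lam (var zero))
  Φ (base (lam M))    = lam (tr M)
  Φ (scal α v)        = α · Φ v
  Φ (plus v w)        = Φ v ⊕ Φ w

  -- The clauses for (α.M)N and (M+N)L are the
  -- paper's clauses with one unfolding of the α.M and M+N clauses inlined:
  --   (α.M) N : K = (α.((M) N)) : K = α.((M) N : K)
  --   (M+N) L : K = ((M) L + (N) L) : K = ((M) L : K) + ((N) L : K)

  _∶_ : ∀ {n} → Term n → Term n → Term n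
  𝟎 ∶ K                   = 𝟎
  var x ∶ K               = app K (Φ (base (var x)))
  lam M ∶ K               = app K (Φ (base (lam M)))
  (α · M) ∶ K             = α · (M ∶ K)
  (M ⊕ N) ∶ K             = (M ∶ K) ⊕ (N ∶ K)
  app 𝟎 N ∶ K             = 𝟎
  app (var x) N ∶ K       = app (app (Φ (base (var x))) (tr N)) K
  app (lam M) N ∶ K       = app (app (Φ (base (lam M))) (tr N)) K
  app (α · M) N ∶ K       = α · (app M N ∶ K)
  app (M ⊕ N) L ∶ K       = (app M L ∶ K) ⊕ (app N L ∶ K)
  -- ((M) N) L : K = (M) N : λf ((f) L̄) K
  app (app M N) L ∶ K     = app M N ∶ lam (app (app (var zero) (wk (tr L))) (wk K))

-- The translation of any term other than a variable is an
-- abstraction, so applied to the base term K it fires β_v; scalars and sums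
-- then leave the application by A_l. For (M) N, one β_v step gives M̄ applied
-- to the base term λf ((f) N̄) K, the induction hypothesis reduces this to
-- M : λf ((f) N̄) K, and one more β_v step under each summand of the latter
-- yields (M) N : K. Closedness is needed because Φ(x) = (x) λy y is not a
-- base term.
module Submission where

open import Defs
open import Algebra.Bundles using (Ring)
open import Data.Nat using (suc)
open import Data.Fin using (zero; suc)
open import Data.Sum using (inj₁; inj₂)
open import Function using (_∘_)
open import Relation.Binary.PropositionalEquality using (_≡_; refl; cong; cong₂; trans)
open import Relation.Binary.Construct.Closure.ReflexiveTransitive using (ε; _◅_; _◅◅_; gmap)

module Colon {c ℓ} (R : Ring c ℓ) where
  open LinCalc R

  sub-cong : ∀ {m n} {σ τ : Sub m n} → (∀ x → σ x ≡ τ x) → ∀ T → sub σ T ≡ sub τ T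
  sub-cong e (var x)   = e x
  sub-cong e (lam T)   = cong lam (sub-cong (λ { zero → refl ; (suc x) → cong wk (e x) }) T)
  sub-cong e (app T U) = cong₂ app (sub-cong e T) (sub-cong e U)
  sub-cong e 𝟎         = refl
  sub-cong e (α · T)   = cong (α ·_) (sub-cong e T)
  sub-cong e (T ⊕ U)   = cong₂ _⊕_ (sub-cong e T) (sub-cong e U)

  sub-id : ∀ {n} {σ : Sub n n} → (∀ x → σ x ≡ var x) → ∀ T → sub σ T ≡ T
  sub-id e (var x)   = e x
  sub-id e (lam T)   = cong lam (sub-id (λ { zero → refl ; (suc x) → cong wk (e x) }) T)
  sub-id e (app T U) = cong₂ app (sub-id e T) (sub-id e U)
  sub-id e 𝟎         = refl
  sub-id e (α · T)   = cong (α ·_) (sub-id e T)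
  sub-id e (T ⊕ U)   = cong₂ _⊕_ (sub-id e T) (sub-id e U)

  sub-ren : ∀ {k m n} (σ : Sub m n) (ρ : Ren k m) T → sub σ (ren ρ T) ≡ sub (σ ∘ ρ) T
  sub-ren σ ρ (var x)   = refl
  sub-ren σ ρ (lam T)   = cong lam (trans (sub-ren (exts σ) (ext ρ) T)
                                          (sub-cong (λ { zero → refl ; (suc x) → refl }) T))
  sub-ren σ ρ (app T U) = cong₂ app (sub-ren σ ρ T) (sub-ren σ ρ U)
  sub-ren σ ρ 𝟎         = refl
  sub-ren σ ρ (α · T)   = cong (α ·_) (sub-ren σ ρ T)
  sub-ren σ ρ (T ⊕ U)   = cong₂ _⊕_ (sub-ren σ ρ T) (sub-ren σ ρ U)

  sub-var≡ren : ∀ {m n} (ρ : Ren m n) T → sub (var ∘ ρ) T ≡ ren ρ T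
  sub-var≡ren ρ (var x)   = refl
  sub-var≡ren ρ (lam T)   = cong lam (trans (sub-cong (λ { zero → refl ; (suc x) → refl }) T)
                                            (sub-var≡ren (ext ρ) T))
  sub-var≡ren ρ (app T U) = cong₂ app (sub-var≡ren ρ T) (sub-var≡ren ρ U)
  sub-var≡ren ρ 𝟎         = refl
  sub-var≡ren ρ (α · T)   = cong (α ·_) (sub-var≡ren ρ T)
  sub-var≡ren ρ (T ⊕ U)   = cong₂ _⊕_ (sub-var≡ren ρ T) (sub-var≡ren ρ U)

  -- The substitution performed by M [ N ] is one, definitionally.
  LeftInverseOfWk : ∀ {n} → Sub (suc n) n → Set c
  LeftInverseOfWk σ = ∀ x → σ (suc x) ≡ var x

  module _ {n} {σ : Sub (suc n) n} (σ∘suc≡var : LeftInverseOfWk σ) where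

    sub-wk : ∀ T → sub σ (wk T) ≡ T
    sub-wk T = trans (sub-ren σ suc T) (sub-id σ∘suc≡var T)

    sub-exts-wk-wk : ∀ T → sub (exts σ) (wk (wk T)) ≡ wk T
    sub-exts-wk-wk T = trans (sub-ren (exts σ) suc (wk T))
      (trans (sub-ren (wk ∘ σ) suc T)
        (trans (sub-cong (cong wk ∘ σ∘suc≡var) T) (sub-var≡ren suc T)))

    sub-exts-ren-ext-suc : ∀ T → sub (exts σ) (ren (ext suc) T) ≡ T
    sub-exts-ren-ext-suc T = trans (sub-ren (exts σ) (ext suc) T)
      (sub-id (λ { zero → refl ; (suc x) → cong wk (σ∘suc≡var x) }) T)

  ℓ-step : ∀ {n} {M N : Term n} → M ↦ℓ N → M →ℓβ* N
  ℓ-step r = inj₁ (ax r) ◅ ε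

  βv-step : ∀ {n} {M : Term (suc n)} {B N : Term n} → Base B → M [ B ] ≡ N →
            app (lam M) B →ℓβ* N
  βv-step b refl = inj₂ (ax (βv b)) ◅ ε

  ctx-lift* : ∀ {n} (C : Term n → Term n) →
              (∀ {Ax : ∀ {k} → Term k → Term k → Set c} {M M'} → Ctx Ax M M' → Ctx Ax (C M) (C M')) →
              ∀ {M M'} → M →ℓβ* M' → C M →ℓβ* C M'
  ctx-lift* C ξ = gmap C λ { (inj₁ r) → inj₁ (ξ r) ; (inj₂ r) → inj₂ (ξ r) }

  ·-cong* : ∀ {n} α {M M' : Term n} → M →ℓβ* M' → (α · M) →ℓβ* (α · M')
  ·-cong* α = ctx-lift* (α ·_) ξ-·

  ⊕-cong* : ∀ {n} {M M' N N' : Term n} → M →ℓβ* M' → N →ℓβ* N' → (M ⊕ N) →ℓβ* (M' ⊕ N')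
  ⊕-cong* {M' = M'} {N = N} p q = ctx-lift* (_⊕ N) ξ-+l p ◅◅ ctx-lift* (M' ⊕_) ξ-+r q

  -- λf ((f) N̄) K, the continuation of the last clause of _∶_.
  argCont : ∀ {n} → Term n → Term n → Term n
  argCont N K = lam (app (app (var zero) (wk (tr N))) (wk K))

  ∶-argCont : ∀ {n} (N K : Term n) (P : Term 0) →
              (close↑ P ∶ argCont N K) →ℓβ* (app (close↑ P) N ∶ K)
  ∶-argCont N K (lam P)   = βv-step (lam _)
    (cong₂ (app ∘ app (lam (tr _))) (sub-wk (λ _ → refl) (tr N)) (sub-wk (λ _ → refl) K))
  ∶-argCont N K (app P Q) = ε
  ∶-argCont N K 𝟎         = ε
  ∶-argCont N K (α · P)   = ·-cong* α (∶-argCont N K P)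
  ∶-argCont N K (P ⊕ Q)   = ⊕-cong* (∶-argCont N K P) (∶-argCont N K Q)

  tr-app→ℓβ*∶ : ∀ {n} (K : Term n) → Base K → (M : Term 0) →
                app (tr (close↑ M)) K →ℓβ* (close↑ M ∶ K)
  tr-app→ℓβ*∶ K b (lam M)   = βv-step b (cong (app K ∘ lam) (sub-exts-ren-ext-suc (λ _ → refl) _))
  tr-app→ℓβ*∶ K b (app M N) =
    βv-step b (cong₂ (λ M̄ N̄ → app M̄ (lam (app (app (var zero) N̄) (wk K))))
                     (sub-wk (λ _ → refl) _) (sub-exts-wk-wk (λ _ → refl) _))
    ◅◅ tr-app→ℓβ*∶ (argCont (close↑ N) K) (lam _) M
    ◅◅ ∶-argCont (close↑ N) K M
  tr-app→ℓβ*∶ K b 𝟎         = βv-step b refl ◅◅ ℓ-step (Al-0 (base b))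
  tr-app→ℓβ*∶ K b (α · M)   =
    βv-step b (cong (λ M̄ → app (α · M̄) K) (sub-wk (λ _ → refl) _))
    ◅◅ ℓ-step (Al-· (base b)) ◅◅ ·-cong* α (tr-app→ℓβ*∶ K b M)
  tr-app→ℓβ*∶ K b (M ⊕ N)   =
    βv-step b (cong₂ (λ M̄ N̄ → app (M̄ ⊕ N̄) K) (sub-wk (λ _ → refl) _) (sub-wk (λ _ → refl) _))
    ◅◅ ℓ-step (Al-+ (base b)) ◅◅ ⊕-cong* (tr-app→ℓβ*∶ K b M) (tr-app→ℓβ*∶ K b N)

lemma10 : ∀ {c ℓ} (R : Ring c ℓ) → let open LinCalc R in
          ∀ {n} (K : Term n) → Base K → (M : Term 0) →
          app (tr (close↑ M)) K →ℓβ* (close↑ M ∶ K)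
lemma10 R = Colon.tr-app→ℓβ*∶ R
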